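{- Let $\mathcal N$ be a (arbitrary) recoverable phylogenetic network, and suppose that $\mathcal N'$ is obtained from $\mathcal N$ by picking either a cherry or a reticulated cherry (i.e. by reducing a leaf of a cherry or cutting a reticulated cherry). Then $\mathcal N'$ is recoverable.
   Context: All paths are directed. A (binary) phylogenetic network $\mathcal N$ on a non-empty finite set $X$ is a rooted acyclic directed graph with no parallel arcs such that: the unique root has in-degree 0 and out-degree 2; the set of vertices of out-degree 0 is $X$ (the leaves), each of in-degree 1; every other vertex has either in-degree 1 and out-degree 2 (tree vertex) or in-degree 2 and out-degree 1 (reticulation). If $|X|=1$, $\mathcal N$ may also be the single vertex of $X$. For $|X|\ge 2$, $p_x$ is the parent of leaf $x$. $\{a,b\}$ is a cherry if $p_a=p_b$; $(a,b)$ is a reticulated cherry if $(p_a,p_b)$ is an arc with $p_b$ a reticulation and $p_a$ a tree vertex. Reducing $b$ of a cherry $\{a,b\}$: delete $b$ and its incident arc, suppress $p_a$ (if $p_a$ is the root, the result is the single vertex $a$). Cutting a reticulated cherry $(a,b)$: delete $(p_a,p_b)$ and suppress the resulting vertices of in-degree one and out-degree one. A stable ancestor of $X'\subseteq X$ is a vertex $u$ such that for every $x\in X'$ every path from the root to $x$ traverses $u$; ${\rm lsa}(X')$ is the unique stable ancestor of $X'$ with no other stable ancestor of $X'$ as a descendant. $\mathcal N$ is recoverable if ${\rm lsa}(X)$ is the root, i.e. no non-root vertex is a stable ancestor of $X$. -}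

module Defs where

open import Data.Nat using (ℕ; zero; suc; _+_)
open import Data.Fin using (Fin; zero; suc; _≟_)
open import Data.Bool using (Bool; true; false; if_then_else_; _∧_; _∨_; not)
open import Data.Product using (_×_; Σ)
open import Data.Sum using (_⊎_)
open import Relation.Nullary using (¬_)
open import Relation.Nullary.Decidable using (⌊_⌋)
open import Relation.Binary.PropositionalEquality using (_≡_; _≢_)

-- A finite directed graph whose potential vertices are Fin n.
-- 'alive v' says whether v is (still) a vertex of the graph;
-- 'arc u v' says whether (u,v) is an arc. Using a Bool relation means
-- there are never parallel arcs.
record Graph (n : ℕ) : Set where
  constructor mkGraph
  field
    alive : Fin n → Bool
    arc   : Fin n → Fin n → Bool
open Graph public

module _ {n : ℕ} (G : Graph n) where

  Alive : Fin n → Set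
  Alive v = alive G v ≡ true

  Arc : Fin n → Fin n → Set
  Arc u v = arc G u v ≡ true

countB : ∀ {n} → (Fin n → Bool) → ℕ
countB {zero}  f = 0
countB {suc n} f = (if f zero then 1 else 0) + countB (λ i → f (suc i))

module _ {n : ℕ} (G : Graph n) where

  inDeg : Fin n → ℕ
  inDeg v = countB (λ u → arc G u v)

  outDeg : Fin n → ℕ
  outDeg v = countB (λ w → arc G v w)

  data Path : Fin n → Fin n → Set where
    []  : ∀ {u} → Path u u
    _∷_ : ∀ {u v w} → Arc G u v → Path v w → Path u w

  Visits : ∀ {u v} → Fin n → Path u v → Set
  Visits x ([] {u}) = x ≡ u
  Visits x (_∷_ {u} e p) = (x ≡ u) ⊎ Visits x p

  IsRoot : Fin n → Set
  IsRoot r = Alive G r × inDeg r ≡ 0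

  IsLeaf : Fin n → Set
  IsLeaf x = Alive G x × outDeg x ≡ 0

  VertexType : Fin n → Set
  VertexType v =
      (inDeg v ≡ 0 × outDeg v ≡ 2)   -- root (|X| ≥ 2)
    ⊎ (inDeg v ≡ 0 × outDeg v ≡ 0)   -- the single vertex (|X| = 1)
    ⊎ (inDeg v ≡ 1 × outDeg v ≡ 0)
    ⊎ (inDeg v ≡ 1 × outDeg v ≡ 2)
    ⊎ (inDeg v ≡ 2 × outDeg v ≡ 1)

  record IsNetwork : Set where
    field
      arcsAlive  : ∀ u v → Arc G u v → Alive G u × Alive G v
      acyclic    : ∀ u v → Arc G u v → ¬ Path v u
      root       : Fin n
      rootIsRoot : IsRoot root
      rootUnique : ∀ v → IsRoot v → v ≡ root
      degrees    : ∀ v → Alive G v → VertexType v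

  StableAncestorX : Fin n → Fin n → Set
  StableAncestorX r u =
    Alive G u × (∀ x → IsLeaf x → (p : Path r x) → Visits u p)

  Recoverable : Set
  Recoverable = ∀ r → IsRoot r → ∀ u → StableAncestorX r u → u ≡ r

_==_ : ∀ {n} → Fin n → Fin n → Bool
u == v = ⌊ u ≟ v ⌋

_=/=_ : ∀ {n} → Fin n → Fin n → Bool
u =/= v = not (u == v)

-- Reduce leaf b of cherry {a,b} with common parent p, where g is the parent
-- of p: delete b and arc (p,b); suppress p (delete p, replace (g,p),(p,a)
-- by (g,a)).
reduceG : ∀ {n} → Graph n → (a b p g : Fin n) → Graph n
reduceG G a b p g = mkGraph
  (λ v → alive G v ∧ (v =/= b) ∧ (v =/= p))
  (λ u v → (arc G u v ∧ (u =/= p) ∧ (v =/= p) ∧ (v =/= b))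
           ∨ ((u == g) ∧ (v == a)))

-- Reduce leaf b of cherry {a,b} whose common parent p is the root:
-- the result is the single vertex a.
reduceRootG : ∀ {n} → Graph n → (a b p : Fin n) → Graph n
reduceRootG G a b p = mkGraph
  (λ v → alive G v ∧ (v =/= b) ∧ (v =/= p))
  (λ u v → arc G u v ∧ (u =/= p) ∧ (v =/= p) ∧ (v =/= b))

-- Cut reticulated cherry (a,b): delete arc (pa,pb); suppress pa (its parent
-- g gets arc (g,a)) and pb (its remaining parent q gets arc (q,b)).
cutG : ∀ {n} → Graph n → (a b pa pb g q : Fin n) → Graph n
cutG G a b pa pb g q = mkGraph
  (λ v → alive G v ∧ (v =/= pa) ∧ (v =/= pb))
  (λ u v → (arc G u v ∧ (u =/= pa) ∧ (u =/= pb) ∧ (v =/= pa) ∧ (v =/= pb))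
           ∨ ((u == g) ∧ (v == a)) ∨ ((u == q) ∧ (v == b)))

data Step {n : ℕ} (G : Graph n) : Graph n → Set where
  reduceCherry : (a b p g : Fin n) → a ≢ b →
    IsLeaf G a → IsLeaf G b → Arc G p a → Arc G p b →
    Arc G g p →
    Step G (reduceG G a b p g)
  reduceCherryAtRoot : (a b p : Fin n) → a ≢ b →
    IsLeaf G a → IsLeaf G b → Arc G p a → Arc G p b →
    IsRoot G p →
    Step G (reduceRootG G a b p)
  cutReticulatedCherry : (a b pa pb g q : Fin n) →
    IsLeaf G a → IsLeaf G b → Arc G pa a → Arc G pb b → Arc G pa pb →
    inDeg G pa ≡ 1 → outDeg G pa ≡ 2 →
    inDeg G pb ≡ 2 → outDeg G pb ≡ 1 →
    Arc G g pa → Arc G q pb → q ≢ pa →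
    Step G (cutG G a b pa pb g q)

-- A path of G from the root to a leaf can be replayed in G′: it is copied arc by arc until
-- it enters one of the suppressed vertices, where a single new arc of G′ takes it straight
-- to a leaf. Every vertex of the replayed path already lies on the original path, except
-- possibly the leaf a, which is then reached in G′ only after the original path has passed
-- through p, the parent of a. So a stable ancestor u ≠ a of X in G′ is one in G, hence the
-- root; and u = a would make p a stable ancestor in G, impossible because p is not the root.
module Submission where

open import Defs
open import Data.Nat using (ℕ; zero; suc; _+_)
import Data.Nat.Properties as ℕ
open import Data.Fin using (Fin; zero; suc; _≟_; punchIn; punchOut)
open import Data.Fin.Properties using (punchIn-punchOut)
open import Data.Bool using (Bool; true; false; if_then_else_; _∧_; _∨_)
open import Data.Bool.Properties using (T-≡)
open import Data.Product using (_×_; _,_; proj₁; proj₂; ∃-syntax; map₂)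
open import Data.Sum using (_⊎_; inj₁; inj₂; [_,_]) renaming (map to ⊎-map)
open import Data.Empty using (⊥; ⊥-elim)
open import Function using (_∘_; id; case_of_)
open import Function.Bundles using (Equivalence)
open import Relation.Nullary using (Dec; yes; no)
open import Relation.Nullary.Decidable using (toWitness; fromWitness; toWitnessFalse; fromWitnessFalse)
open import Relation.Binary.PropositionalEquality using (_≡_; _≢_; refl; sym; trans; cong; subst; module ≡-Reasoning)
open import Algebra.Properties.CommutativeSemigroup ℕ.+-commutativeSemigroup using (x∙yz≈y∙xz)

∧-≡-true⁻ : ∀ {x y} → x ∧ y ≡ true → x ≡ true × y ≡ true
∧-≡-true⁻ {true} y≡true = refl , y≡true

∧-≡-true⁺ : ∀ {x y} → x ≡ true → y ≡ true → x ∧ y ≡ true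
∧-≡-true⁺ refl y≡true = y≡true

∨-≡-true⁻ : ∀ {x y} → x ∨ y ≡ true → x ≡ true ⊎ y ≡ true
∨-≡-true⁻ {true}  _       = inj₁ refl
∨-≡-true⁻ {false} y≡true = inj₂ y≡true

∨-≡-trueˡ : ∀ {x y} → x ≡ true → x ∨ y ≡ true
∨-≡-trueˡ refl = refl

∨-≡-trueʳ : ∀ x {y} → y ≡ true → x ∨ y ≡ true
∨-≡-trueʳ true  _       = refl
∨-≡-trueʳ false y≡true = y≡true

==-refl : ∀ {n} (u : Fin n) → (u == u) ≡ true
==-refl u = Equivalence.to T-≡ (fromWitness {a? = u ≟ u} refl)

module _ {n : ℕ} {u v : Fin n} where

  ==⇒≡ : (u == v) ≡ true → u ≡ v
  ==⇒≡ = toWitness {a? = u ≟ v} ∘ Equivalence.from T-≡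

  =/=⇒≢ : (u =/= v) ≡ true → u ≢ v
  =/=⇒≢ = toWitnessFalse {a? = u ≟ v} ∘ Equivalence.from T-≡

  ≢⇒=/= : u ≢ v → (u =/= v) ≡ true
  ≢⇒=/= = Equivalence.to T-≡ ∘ fromWitnessFalse {a? = u ≟ v}

countB≡0⇒≢true : ∀ {n} (f : Fin n → Bool) → countB f ≡ 0 → ∀ i → f i ≢ true
countB≡0⇒≢true {suc n} f count≡0 i fi with f zero in f0
countB≡0⇒≢true {suc n} f () i fi | true
countB≡0⇒≢true {suc n} f count≡0 zero    fi | false = case trans (sym f0) fi of λ ()
countB≡0⇒≢true {suc n} f count≡0 (suc i) fi | false = countB≡0⇒≢true (f ∘ suc) count≡0 i fi

≢true⇒countB≡0 : ∀ {n} (f : Fin n → Bool) → (∀ i → f i ≢ true) → countB f ≡ 0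
≢true⇒countB≡0 {zero}  f _     = refl
≢true⇒countB≡0 {suc n} f ≢true with f zero in f0
... | true  = ⊥-elim (≢true zero f0)
... | false = ≢true⇒countB≡0 (f ∘ suc) (≢true ∘ suc)

countB-punchIn : ∀ {n} (f : Fin (suc n) → Bool) i →
                 countB f ≡ (if f i then 1 else 0) + countB (f ∘ punchIn i)
countB-punchIn f zero = refl
countB-punchIn {suc n} f (suc i) =
  trans (cong ((if f zero then 1 else 0) +_) (countB-punchIn (f ∘ suc) i))
        (x∙yz≈y∙xz (if f zero then 1 else 0) (if f (suc i) then 1 else 0) _)

module _ {n : ℕ} (f : Fin (suc n) → Bool) {i : Fin (suc n)} (fi : f i ≡ true) where

  countB-without : countB f ≡ suc (countB (f ∘ punchIn i))
  countB-without rewrite countB-punchIn f i | fi = refl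

  true-without : ∀ {j} (i≢j : i ≢ j) → f j ≡ true → (f ∘ punchIn i) (punchOut i≢j) ≡ true
  true-without i≢j = subst (λ k → f k ≡ true) (sym (punchIn-punchOut i≢j))

countB≡1⇒≡ : ∀ {n} (f : Fin n → Bool) → countB f ≡ 1 →
             ∀ {i j} → f i ≡ true → f j ≡ true → i ≡ j
countB≡1⇒≡ {suc n} f count≡1 {i} {j} fi fj with i ≟ j
... | yes i≡j = i≡j
... | no i≢j  =
  ⊥-elim (countB≡0⇒≢true (f ∘ punchIn i) rest≡0 (punchOut i≢j) (true-without f fi i≢j fj))
  where rest≡0 = ℕ.suc-injective (trans (sym (countB-without f fi)) count≡1)

countB≡2⇒≡⊎≡ : ∀ {n} (f : Fin n → Bool) → countB f ≡ 2 →
               ∀ {i j k} → f i ≡ true → f j ≡ true → i ≢ j → f k ≡ true → k ≡ i ⊎ k ≡ j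
countB≡2⇒≡⊎≡ {suc n} f count≡2 {i} {j} {k} fi fj i≢j fk with i ≟ k
... | yes i≡k = inj₁ (sym i≡k)
... | no i≢k  = inj₂ (begin
      k                         ≡⟨ sym (punchIn-punchOut i≢k) ⟩
      punchIn i (punchOut i≢k)  ≡⟨ cong (punchIn i) (countB≡1⇒≡ (f ∘ punchIn i) rest≡1
                                     (true-without f fi i≢k fk) (true-without f fi i≢j fj)) ⟩
      punchIn i (punchOut i≢j)  ≡⟨ punchIn-punchOut i≢j ⟩
      j                         ∎)
  where
    open ≡-Reasoning
    rest≡1 = ℕ.suc-injective (trans (sym (countB-without f fi)) count≡2)

module _ {n : ℕ} (G : Graph n) where

  visits-start : ∀ {v x} (P : Path G v x) → Visits G v P
  visits-start []      = refl
  visits-start (_ ∷ _) = inj₁ refl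

  visits-parent : ∀ {q x v y} → (∀ {w} → Arc G w x → w ≡ q) →
                  (P : Path G v y) → v ≢ x → Visits G x P → Visits G q P
  visits-parent parent []                 v≢x x≡v        = ⊥-elim (v≢x (sym x≡v))
  visits-parent parent (e ∷ P)            v≢x (inj₁ x≡v) = ⊥-elim (v≢x (sym x≡v))
  visits-parent {x = x} parent (_∷_ {v = v₁} e P) v≢x (inj₂ x∈P) with v₁ ≟ x
  ... | yes refl = inj₁ (sym (parent e))
  ... | no v₁≢x  = inj₂ (visits-parent parent P v₁≢x x∈P)

  visits-child : ∀ {c v x} → (∀ {w} → Arc G v w → w ≡ c) →
                 (P : Path G v x) → v ≢ x → Visits G c P
  visits-child child []      v≢x = ⊥-elim (v≢x refl)
  visits-child child (e ∷ P) _   = inj₂ (subst (λ w → Visits G w P) (child e) (visits-start P))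

  root-parentless : ∀ {r w} → IsRoot G r → Arc G w r → ⊥
  root-parentless {r} (_ , inDeg≡0) = countB≡0⇒≢true (λ u → arc G u r) inDeg≡0 _

  leaf-childless : ∀ {x w} → IsLeaf G x → Arc G x w → ⊥
  leaf-childless {x} (_ , outDeg≡0) = countB≡0⇒≢true (arc G x) outDeg≡0 _

module Network {n : ℕ} {G : Graph n} (net : IsNetwork G) where
  open IsNetwork net

  outDeg≡2 : ∀ {v c₁ c₂} → Arc G v c₁ → Arc G v c₂ → c₁ ≢ c₂ → outDeg G v ≡ 2
  outDeg≡2 {v} e₁ e₂ c₁≢c₂ with degrees v (proj₁ (arcsAlive _ _ e₁))
  ... | inj₁ (_ , out≡2)                         = out≡2
  ... | inj₂ (inj₁ (_ , out≡0))                  = ⊥-elim (countB≡0⇒≢true (arc G v) out≡0 _ e₁)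
  ... | inj₂ (inj₂ (inj₁ (_ , out≡0)))           = ⊥-elim (countB≡0⇒≢true (arc G v) out≡0 _ e₁)
  ... | inj₂ (inj₂ (inj₂ (inj₁ (_ , out≡2))))    = out≡2
  ... | inj₂ (inj₂ (inj₂ (inj₂ (_ , out≡1))))    = ⊥-elim (c₁≢c₂ (countB≡1⇒≡ (arc G v) out≡1 e₁ e₂))

  inDeg≡1 : ∀ {w v} → Arc G w v → outDeg G v ≢ 1 → inDeg G v ≡ 1
  inDeg≡1 {v = v} e out≢1 with degrees v (proj₂ (arcsAlive _ _ e))
  ... | inj₁ (in≡0 , _)                          = ⊥-elim (countB≡0⇒≢true (λ u → arc G u v) in≡0 _ e)
  ... | inj₂ (inj₁ (in≡0 , _))                   = ⊥-elim (countB≡0⇒≢true (λ u → arc G u v) in≡0 _ e)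
  ... | inj₂ (inj₂ (inj₁ (in≡1 , _)))            = in≡1
  ... | inj₂ (inj₂ (inj₂ (inj₁ (in≡1 , _))))     = in≡1
  ... | inj₂ (inj₂ (inj₂ (inj₂ (_ , out≡1))))    = ⊥-elim (out≢1 out≡1)

  leaf-parent : ∀ {x w} → IsLeaf G x → Arc G w x → ∀ {w′} → Arc G w′ x → w′ ≡ w
  leaf-parent {x} (_ , out≡0) e e′ =
    countB≡1⇒≡ (λ u → arc G u x) (inDeg≡1 e (λ out≡1 → case trans (sym out≡0) out≡1 of λ ())) e′ e

module _ {n : ℕ} (G G′ : Graph n) where

  isRoot-reflect : ∀ {r} → Alive G r → (∀ {w} → Arc G w r → ∃[ w′ ] Arc G′ w′ r) →
                   IsRoot G′ r → IsRoot G r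
  isRoot-reflect {r} r-alive parent′ r-root′ =
    r-alive , ≢true⇒countB≡0 (λ u → arc G u r) (λ w e → root-parentless G′ r-root′ (proj₂ (parent′ e)))

  isLeaf-transfer : ∀ {x} → Alive G′ x → IsLeaf G x →
                    (∀ {u v} → Arc G′ u v → ∃[ w ] Arc G u w) → IsLeaf G′ x
  isLeaf-transfer {x} x-alive′ x-leaf child =
    x-alive′ , ≢true⇒countB≡0 (arc G′ x) (λ w e → leaf-childless G x-leaf (proj₂ (child e)))

module Shadowing {n : ℕ} (G G′ : Graph n) (a p : Fin n) where

  Covered : ∀ {v x} → Path G v x → Fin n → Set
  Covered P w = Visits G w P ⊎ (w ≡ a × Visits G p P)

  record Shadow {v x : Fin n} (P : Path G v x) : Set where
    constructor shadow
    field
      end     : Fin n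
      path    : Path G′ v end
      isLeaf  : IsLeaf G′ end
      covered : ∀ w → Visits G′ w path → Covered P w

  shadow-[] : ∀ {x} → IsLeaf G′ x → Shadow {x} {x} []
  shadow-[] x-leaf = shadow _ [] x-leaf (λ _ → inj₁)

  shadow-∷ : ∀ {v v₁ x} (e : Arc G v v₁) {P : Path G v₁ x} → Arc G′ v v₁ → Shadow P → Shadow (e ∷ P)
  shadow-∷ e e′ (shadow y P′ y-leaf covered) = shadow y (e′ ∷ P′) y-leaf λ where
    w (inj₁ w≡v)  → inj₁ (inj₁ w≡v)
    w (inj₂ w∈P′) → ⊎-map inj₂ (map₂ inj₂) (covered w w∈P′)

  shadow-jump : ∀ {v y x} {P : Path G v x} → Arc G′ v y → IsLeaf G′ y → Covered P y → Shadow P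
  shadow-jump {P = P} e′ y-leaf y-covered = shadow _ (e′ ∷ []) y-leaf λ where
    w (inj₁ refl) → inj₁ (visits-start G P)
    w (inj₂ refl) → y-covered

  shadows⇒recoverable : ∀ {g} → Recoverable G → Alive G p → Arc G g p → Arc G p a →
    (∀ {w} → Arc G w a → w ≡ p) →
    (∀ {v} → Alive G′ v → Alive G v) →
    (∀ {r} → IsRoot G′ r → IsRoot G r) →
    (∀ {v x} → Alive G′ v → IsLeaf G x → (P : Path G v x) → Shadow P) →
    Recoverable G′
  shadows⇒recoverable {g} recoverable p-alive g→p p→a a-parent alive-reflect root-reflect shadows
                      r r-root′ u (u-alive′ , u-stable′) = stable⇒root (u ≟ a)
    where
      r-root : IsRoot G r
      r-root = root-reflect r-root′

      covered-u : ∀ {x} → IsLeaf G x → (P : Path G r x) → Covered P u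
      covered-u x-leaf P with shadows (proj₁ r-root′) x-leaf P
      ... | shadow y P′ y-leaf covered = covered u (u-stable′ y y-leaf P′)

      stable⇒root : Dec (u ≡ a) → u ≡ r
      stable⇒root (no u≢a) = recoverable r r-root u (alive-reflect u-alive′ , λ x x-leaf P →
        [ id , (λ (u≡a , _) → ⊥-elim (u≢a u≡a)) ] (covered-u x-leaf P))
      stable⇒root (yes refl) = ⊥-elim (root-parentless G r-root (subst (Arc G g) p≡r g→p))
        where
          r≢a : r ≢ a
          r≢a refl = root-parentless G r-root p→a

          p≡r : p ≡ r
          p≡r = recoverable r r-root p (p-alive , λ x x-leaf P →
            [ visits-parent G a-parent P r≢a , proj₂ ] (covered-u x-leaf P))

module ReduceCherry {n : ℕ} {G : Graph n} (net : IsNetwork G) {a b p g : Fin n} (a≢b : a ≢ b)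
  (a-leaf : IsLeaf G a) (b-leaf : IsLeaf G b)
  (p→a : Arc G p a) (p→b : Arc G p b) (g→p : Arc G g p) where
  open IsNetwork net
  open Network net

  G′ : Graph n
  G′ = reduceG G a b p g
  open Shadowing G G′ a p

  p-outDeg≡2 : outDeg G p ≡ 2
  p-outDeg≡2 = outDeg≡2 p→a p→b a≢b

  p-children : ∀ {w} → Arc G p w → w ≡ a ⊎ w ≡ b
  p-children = countB≡2⇒≡⊎≡ (arc G p) p-outDeg≡2 p→a p→b a≢b

  p-parent : ∀ {w} → Arc G w p → w ≡ g
  p-parent e = countB≡1⇒≡ (λ u → arc G u p) p-inDeg≡1 e g→p
    where p-inDeg≡1 = inDeg≡1 g→p (λ out≡1 → case trans (sym p-outDeg≡2) out≡1 of λ ())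

  alive⁻ : ∀ {v} → Alive G′ v → Alive G v × v ≢ b × v ≢ p
  alive⁻ v-alive′ with ∧-≡-true⁻ v-alive′
  ... | v-alive , rest with ∧-≡-true⁻ rest
  ...   | v=/=b , v=/=p = v-alive , =/=⇒≢ v=/=b , =/=⇒≢ v=/=p

  alive⁺ : ∀ {v} → Alive G v → v ≢ b → v ≢ p → Alive G′ v
  alive⁺ v-alive v≢b v≢p = ∧-≡-true⁺ v-alive (∧-≡-true⁺ (≢⇒=/= v≢b) (≢⇒=/= v≢p))

  arc-kept : ∀ {u v} → Arc G u v → u ≢ p → v ≢ p → v ≢ b → Arc G′ u v
  arc-kept e u≢p v≢p v≢b =
    ∨-≡-trueˡ (∧-≡-true⁺ e (∧-≡-true⁺ (≢⇒=/= u≢p) (∧-≡-true⁺ (≢⇒=/= v≢p) (≢⇒=/= v≢b))))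

  g→a : Arc G′ g a
  g→a = ∨-≡-trueʳ (arc G g a ∧ (g =/= p) ∧ (a =/= p) ∧ (a =/= b)) (∧-≡-true⁺ (==-refl g) (==-refl a))

  child-reflect : ∀ {u v} → Arc G′ u v → ∃[ w ] Arc G u w
  child-reflect e′ with ∨-≡-true⁻ e′
  ... | inj₁ kept = _ , proj₁ (∧-≡-true⁻ kept)
  ... | inj₂ new  = p , subst (λ u → Arc G u p) (sym (==⇒≡ (proj₁ (∧-≡-true⁻ new)))) g→p

  parent-reflect : ∀ {v} → Alive G′ v → ∀ {w} → Arc G w v → ∃[ w′ ] Arc G′ w′ v
  parent-reflect v-alive′ {w} e with alive⁻ v-alive′ | w ≟ p
  ... | _ , v≢b , v≢p | no w≢p  = w , arc-kept e w≢p v≢p v≢b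
  ... | _ , v≢b , _   | yes refl with p-children e
  ...   | inj₁ refl = g , g→a
  ...   | inj₂ v≡b  = ⊥-elim (v≢b v≡b)

  leaf⁺ : ∀ {x} → IsLeaf G x → x ≢ b → IsLeaf G′ x
  leaf⁺ x-leaf x≢b = isLeaf-transfer G G′ (alive⁺ (proj₁ x-leaf) x≢b x≢p) x-leaf child-reflect
    where x≢p = λ { refl → leaf-childless G x-leaf p→a }

  shadows : ∀ {v x} → Alive G′ v → IsLeaf G x → (P : Path G v x) → Shadow P
  shadows v-alive′ x-leaf [] = shadow-[] (leaf⁺ x-leaf (proj₁ (proj₂ (alive⁻ v-alive′))))
  shadows v-alive′ x-leaf (_∷_ {v = v₁} e P) with alive⁻ v-alive′ | v₁ ≟ p
  ... | _ , _ , _   | yes refl =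
    shadow-jump (subst (λ u → Arc G′ u a) (sym (p-parent e)) g→a) (leaf⁺ a-leaf a≢b)
                (inj₂ (refl , inj₂ (visits-start G P)))
  ... | _ , _ , v≢p | no v₁≢p =
    shadow-∷ e (arc-kept e v≢p v₁≢p v₁≢b) (shadows (alive⁺ (proj₂ (arcsAlive _ _ e)) v₁≢b v₁≢p) x-leaf P)
    where v₁≢b = λ { refl → v≢p (leaf-parent b-leaf p→b e) }

  recoverable : Recoverable G → Recoverable G′
  recoverable rec =
    shadows⇒recoverable rec (proj₂ (arcsAlive _ _ g→p)) g→p p→a (leaf-parent a-leaf p→a)
      (proj₁ ∘ alive⁻) root-reflect shadows
    where
      root-reflect : ∀ {r} → IsRoot G′ r → IsRoot G r
      root-reflect r-root′ =
        isRoot-reflect G G′ (proj₁ (alive⁻ (proj₁ r-root′))) (parent-reflect (proj₁ r-root′)) r-root′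

module ReduceCherryAtRoot {n : ℕ} {G : Graph n} (net : IsNetwork G) {a b p : Fin n} (a≢b : a ≢ b)
  (a-leaf : IsLeaf G a) (p→a : Arc G p a) (p→b : Arc G p b) (p-root : IsRoot G p) where
  open IsNetwork net
  open Network net

  G′ : Graph n
  G′ = reduceRootG G a b p

  p-children : ∀ {w} → Arc G p w → w ≡ a ⊎ w ≡ b
  p-children = countB≡2⇒≡⊎≡ (arc G p) (outDeg≡2 p→a p→b a≢b) p→a p→b a≢b

  alive⁻ : ∀ {v} → Alive G′ v → Alive G v × v ≢ b × v ≢ p
  alive⁻ v-alive′ with ∧-≡-true⁻ v-alive′
  ... | v-alive , rest with ∧-≡-true⁻ rest
  ...   | v=/=b , v=/=p = v-alive , =/=⇒≢ v=/=b , =/=⇒≢ v=/=p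

  arc-kept : ∀ {u v} → Arc G u v → u ≢ p → v ≢ p → v ≢ b → Arc G′ u v
  arc-kept e u≢p v≢p v≢b = ∧-≡-true⁺ e (∧-≡-true⁺ (≢⇒=/= u≢p) (∧-≡-true⁺ (≢⇒=/= v≢p) (≢⇒=/= v≢b)))

  a-leaf′ : IsLeaf G′ a
  a-leaf′ = isLeaf-transfer G G′ a-alive′ a-leaf (λ e′ → _ , proj₁ (∧-≡-true⁻ e′))
    where
      a≢p = λ { refl → leaf-childless G a-leaf p→a }
      a-alive′ = ∧-≡-true⁺ (proj₁ a-leaf) (∧-≡-true⁺ (≢⇒=/= a≢b) (≢⇒=/= a≢p))

  root≡a : ∀ {r} → IsRoot G′ r → r ≡ a
  root≡a {r} r-root′ with alive⁻ (proj₁ r-root′) | r ≟ a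
  ... | _       , _   , _   | yes r≡a = r≡a
  ... | r-alive , r≢b , r≢p | no r≢a  =
    ⊥-elim (r≢p (trans (rootUnique r r-root) (sym (rootUnique p p-root))))
    where
      parent-reflect : ∀ {w} → Arc G w r → ∃[ w′ ] Arc G′ w′ r
      parent-reflect {w} e with w ≟ p
      ... | no w≢p  = w , arc-kept e w≢p r≢p r≢b
      ... | yes refl = ⊥-elim ([ r≢a , r≢b ] (p-children e))

      r-root : IsRoot G r
      r-root = isRoot-reflect G G′ r-alive parent-reflect r-root′

  recoverable : Recoverable G′
  recoverable r r-root′ u (_ , u-stable′) with root≡a r-root′
  ... | refl = u-stable′ a a-leaf′ []

module CutReticulatedCherry {n : ℕ} {G : Graph n} (net : IsNetwork G) {a b pa pb g q : Fin n}
  (a-leaf : IsLeaf G a) (b-leaf : IsLeaf G b)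
  (pa→a : Arc G pa a) (pb→b : Arc G pb b) (pa→pb : Arc G pa pb)
  (pa-inDeg : inDeg G pa ≡ 1) (pa-outDeg : outDeg G pa ≡ 2)
  (pb-inDeg : inDeg G pb ≡ 2) (pb-outDeg : outDeg G pb ≡ 1)
  (g→pa : Arc G g pa) (q→pb : Arc G q pb) (q≢pa : q ≢ pa) where
  open IsNetwork net
  open Network net

  G′ : Graph n
  G′ = cutG G a b pa pb g q
  open Shadowing G G′ a pa

  pa-parent : ∀ {w} → Arc G w pa → w ≡ g
  pa-parent e = countB≡1⇒≡ (λ u → arc G u pa) pa-inDeg e g→pa

  pa-children : ∀ {w} → Arc G pa w → w ≡ a ⊎ w ≡ pb
  pa-children = countB≡2⇒≡⊎≡ (arc G pa) pa-outDeg pa→a pa→pb (λ { refl → leaf-childless G a-leaf pb→b })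

  pb-parents : ∀ {w} → Arc G w pb → w ≡ pa ⊎ w ≡ q
  pb-parents = countB≡2⇒≡⊎≡ (λ u → arc G u pb) pb-inDeg pa→pb q→pb (q≢pa ∘ sym)

  pb-child : ∀ {w} → Arc G pb w → w ≡ b
  pb-child e = countB≡1⇒≡ (arc G pb) pb-outDeg e pb→b

  alive⁻ : ∀ {v} → Alive G′ v → Alive G v × v ≢ pa × v ≢ pb
  alive⁻ v-alive′ with ∧-≡-true⁻ v-alive′
  ... | v-alive , rest with ∧-≡-true⁻ rest
  ...   | v=/=pa , v=/=pb = v-alive , =/=⇒≢ v=/=pa , =/=⇒≢ v=/=pb

  alive⁺ : ∀ {v} → Alive G v → v ≢ pa → v ≢ pb → Alive G′ v
  alive⁺ v-alive v≢pa v≢pb = ∧-≡-true⁺ v-alive (∧-≡-true⁺ (≢⇒=/= v≢pa) (≢⇒=/= v≢pb))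

  arc-kept : ∀ {u v} → Arc G u v → u ≢ pa → u ≢ pb → v ≢ pa → v ≢ pb → Arc G′ u v
  arc-kept e u≢pa u≢pb v≢pa v≢pb = ∨-≡-trueˡ (∧-≡-true⁺ e (∧-≡-true⁺ (≢⇒=/= u≢pa)
    (∧-≡-true⁺ (≢⇒=/= u≢pb) (∧-≡-true⁺ (≢⇒=/= v≢pa) (≢⇒=/= v≢pb)))))

  g→a : Arc G′ g a
  g→a = ∨-≡-trueʳ (arc G g a ∧ (g =/= pa) ∧ (g =/= pb) ∧ (a =/= pa) ∧ (a =/= pb))
          (∨-≡-trueˡ (∧-≡-true⁺ (==-refl g) (==-refl a)))

  q→b : Arc G′ q b
  q→b = ∨-≡-trueʳ (arc G q b ∧ (q =/= pa) ∧ (q =/= pb) ∧ (b =/= pa) ∧ (b =/= pb))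
          (∨-≡-trueʳ ((q == g) ∧ (b == a)) (∧-≡-true⁺ (==-refl q) (==-refl b)))

  child-reflect : ∀ {u v} → Arc G′ u v → ∃[ w ] Arc G u w
  child-reflect e′ with ∨-≡-true⁻ e′
  ... | inj₁ kept = _ , proj₁ (∧-≡-true⁻ kept)
  ... | inj₂ new with ∨-≡-true⁻ new
  ...   | inj₁ g→a′ = pa , subst (λ u → Arc G u pa) (sym (==⇒≡ (proj₁ (∧-≡-true⁻ g→a′)))) g→pa
  ...   | inj₂ q→b′ = pb , subst (λ u → Arc G u pb) (sym (==⇒≡ (proj₁ (∧-≡-true⁻ q→b′)))) q→pb

  parent-reflect : ∀ {v} → Alive G′ v → ∀ {w} → Arc G w v → ∃[ w′ ] Arc G′ w′ v
  parent-reflect v-alive′ {w} e with alive⁻ v-alive′ | w ≟ pa | w ≟ pb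
  ... | _ , _ , v≢pb | yes refl | _ with pa-children e
  ...   | inj₁ refl = g , g→a
  ...   | inj₂ v≡pb = ⊥-elim (v≢pb v≡pb)
  parent-reflect v-alive′ e | _ | no _ | yes refl with pb-child e
  ...   | refl = q , q→b
  parent-reflect v-alive′ {w} e | _ , v≢pa , v≢pb | no w≢pa | no w≢pb =
    w , arc-kept e w≢pa w≢pb v≢pa v≢pb

  leaf⁺ : ∀ {x} → IsLeaf G x → IsLeaf G′ x
  leaf⁺ x-leaf = isLeaf-transfer G G′ (alive⁺ (proj₁ x-leaf) x≢pa x≢pb) x-leaf child-reflect
    where
      x≢pa = λ { refl → leaf-childless G x-leaf pa→a }
      x≢pb = λ { refl → leaf-childless G x-leaf pb→b }

  shadows : ∀ {v x} → Alive G′ v → IsLeaf G x → (P : Path G v x) → Shadow P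
  shadows v-alive′ x-leaf [] = shadow-[] (leaf⁺ x-leaf)
  shadows v-alive′ x-leaf (_∷_ {v = v₁} e P) with alive⁻ v-alive′ | v₁ ≟ pa | v₁ ≟ pb
  ... | _ | yes refl | _ =
    shadow-jump (subst (λ u → Arc G′ u a) (sym (pa-parent e)) g→a) (leaf⁺ a-leaf)
                (inj₂ (refl , inj₂ (visits-start G P)))
  ... | _ , v≢pa , _ | no _ | yes refl =
    shadow-jump (subst (λ u → Arc G′ u b) (sym v≡q) q→b) (leaf⁺ b-leaf)
                (inj₁ (inj₂ (visits-child G pb-child P pb≢x)))
    where
      v≡q = [ (λ v≡pa → ⊥-elim (v≢pa v≡pa)) , id ] (pb-parents e)
      pb≢x = λ { refl → leaf-childless G x-leaf pb→b }
  ... | _ , v≢pa , v≢pb | no v₁≢pa | no v₁≢pb =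
    shadow-∷ e (arc-kept e v≢pa v≢pb v₁≢pa v₁≢pb)
             (shadows (alive⁺ (proj₂ (arcsAlive _ _ e)) v₁≢pa v₁≢pb) x-leaf P)

  recoverable : Recoverable G → Recoverable G′
  recoverable rec =
    shadows⇒recoverable rec (proj₂ (arcsAlive _ _ g→pa)) g→pa pa→a (leaf-parent a-leaf pa→a)
      (proj₁ ∘ alive⁻) root-reflect shadows
    where
      root-reflect : ∀ {r} → IsRoot G′ r → IsRoot G r
      root-reflect r-root′ =
        isRoot-reflect G G′ (proj₁ (alive⁻ (proj₁ r-root′))) (parent-reflect (proj₁ r-root′)) r-root′

lemma3p2 : (n : ℕ) (G : Graph n) → IsNetwork G → Recoverable G →
           (G' : Graph n) → Step G G' → Recoverable G'
lemma3p2 n G net rec _ (reduceCherry a b p g a≢b a-leaf b-leaf p→a p→b g→p) =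
  ReduceCherry.recoverable net a≢b a-leaf b-leaf p→a p→b g→p rec
lemma3p2 n G net rec _ (reduceCherryAtRoot a b p a≢b a-leaf _ p→a p→b p-root) =
  ReduceCherryAtRoot.recoverable net a≢b a-leaf p→a p→b p-root
lemma3p2 n G net rec _ (cutReticulatedCherry a b pa pb g q a-leaf b-leaf pa→a pb→b pa→pb
                                             pa-in pa-out pb-in pb-out g→pa q→pb q≢pa) =
  CutReticulatedCherry.recoverable net a-leaf b-leaf pa→a pb→b pa→pb
    pa-in pa-out pb-in pb-out g→pa q→pb q≢pa rec
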